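{- Let $d\leq n\in\mathbb{N}$. Suppose $A \subset 2^{[n]}$ satisfies $\textsf{VC-dim}(\{S\triangle T \mid S,T\in A\}) \leq d$, where $\triangle$ denotes symmetric difference. Then $\lvert A\rvert \leq 2 {n \choose \leq \lfloor d/2\rfloor}$.
   Context: The VC dimension of a family $A\subseteq 2^{[n]}$ is the size of the largest $Y\subseteq[n]$ such that $\{S\cap Y \mid S\in A\}=2^Y$. ${n\choose \leq k}$ denotes $\sum_{i=0}^{k}{n\choose i}$. -}

module Defs where

open import Data.Nat using (ℕ; _≤_; _+_)
open import Data.Nat.Combinatorics using (_C_)
open import Data.Fin.Subset using (Subset; _∩_; _∪_; _─_; _⊆_; ∣_∣)
open import Data.List using (List)
open import Data.List.Membership.Propositional using (_∈_)
open import Data.Product using (∃; _×_)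
open import Relation.Binary.PropositionalEquality using (_≡_)

Family : ℕ → Set₁
Family n = Subset n → Set

_△_ : ∀ {n} → Subset n → Subset n → Subset n
S △ T = (S ─ T) ∪ (T ─ S)

ΔFamily : ∀ {n} → List (Subset n) → Family n
ΔFamily A X = ∃ λ S → ∃ λ T → S ∈ A × T ∈ A × X ≡ S △ T

Shatters : ∀ {n} → Family n → Subset n → Set
Shatters F Y = ∀ Z → Z ⊆ Y → ∃ λ S → F S × S ∩ Y ≡ Z

VCDimAtMost : ∀ {n} → Family n → ℕ → Set
VCDimAtMost F d = ∀ Y → Shatters F Y → ∣ Y ∣ ≤ d

choose≤ : ℕ → ℕ → ℕ
choose≤ n ℕ.zero = n C 0
choose≤ n (ℕ.suc k) = choose≤ n k + n C (ℕ.suc k)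

-- The polynomial method over GF(2).
--
-- Let k = ⌊d/2⌋.  By the interpolation lemma there is a multilinear
-- polynomial P over GF(2) with P(X) = [X = ∅] for every X ∈ {S △ T | S,T ∈ A}
-- all of whose monomials are shattered by that family; by the VC bound
-- deg P ≤ d.  Expanding P(a ⊕ b) monomial by monomial, every monomial of
-- degree ≤ d = (deg in a) + (deg in b) has degree ≤ k in a or in b, so
--   P(a ⊕ b) = Σ_{|Y|≤k} G_Y(b)·a^Y + Σ_{|Y|≤k} T_Y(a)·b^Y        (splitting).
-- Hence the A × A identity matrix [a = b] = P(a ⊕ b) factors as U(a)·V(b)
-- through GF(2)^m with m = 2·#{Y : |Y| ≤ k} = 2·(n choose ≤ k), and an identity
-- matrix of size |A| cannot factor through fewer than |A| dimensions.

module Submission where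

open import Defs
open import Data.Bool using (Bool; true; false; not; _∧_; _xor_)
open import Data.Bool.Properties
  using (xor-∧-commutativeRing; xor-same; xor-assoc; xor-comm; xor-identityʳ;
         ∧-comm; ∧-assoc; ∧-identityʳ; ∧-zeroʳ; ∧-distribˡ-xor; ∧-distribʳ-xor)
import Data.Bool.Properties as Bool
open import Data.Empty using (⊥-elim)
open import Data.Fin using (Fin; zero; suc)
open import Data.Fin.Subset using (Subset; ∣_∣)
open import Data.Fin.Subset.Properties using (drop-∷-⊆)
open import Data.List using (List; []; _∷_; length)
open import Data.List.Membership.Propositional using (_∈_; find; lose)
import Data.List.Relation.Unary.All as All
open import Data.List.Relation.Unary.AllPairs using (_∷_)
open import Data.List.Relation.Unary.Any using (Any; here; there; any?)
open import Data.List.Relation.Unary.Unique.Propositional using (Unique)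
open import Data.Maybe using (just; nothing)
open import Data.Nat using (ℕ; zero; suc; pred; _+_; _*_; _/_; _≤_; _<_; z≤n; s≤s)
open import Data.Nat.Combinatorics using (_C_; nCk+nC[k+1]≡[n+1]C[k+1])
open import Data.Nat.DivMod using (m≡m%n+[m/n]*n; m%n<n)
open import Data.Nat.Properties
  using (≤-trans; ≤-refl; ≤-reflexive; ≤-pred; pred-mono-≤; pred[n]≤n;
         +-suc; +-comm; +-identityʳ; +-monoˡ-≤)
import Data.Nat.Tactic.RingSolver as ℕ-Solver
open import Data.Product using (∃; _×_; _,_; proj₁; proj₂)
open import Data.Sum using (_⊎_; inj₁; inj₂)
open import Data.Vec using (Vec; []; _∷_; _++_; map; zipWith; replicate; lookup; removeAt; here)
open import Data.Vec.Properties using (lookup-map; lookup-zipWith; ≡-dec)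
open import Relation.Binary.PropositionalEquality
  using (_≡_; _≢_; refl; sym; trans; cong; cong₂; subst; subst₂; module ≡-Reasoning)
open import Relation.Nullary using (Dec; yes; no)
open import Relation.Nullary.Decidable using (map′; _×-dec_; _⊎-dec_)
open import Tactic.RingSolver using (solve-∀)
open import Tactic.RingSolver.Core.AlmostCommutativeRing
  using (AlmostCommutativeRing; fromCommutativeRing)

open ≡-Reasoning

private
  variable
    m n : ℕ

GF2 : AlmostCommutativeRing _ _
GF2 = fromCommutativeRing xor-∧-commutativeRing λ { false → just refl ; true → nothing }

xor-cancelʳ : ∀ p q → (p xor q) xor q ≡ p
xor-cancelʳ p q = begin
  (p xor q) xor q  ≡⟨ xor-assoc p q q ⟩
  p xor (q xor q)  ≡⟨ cong (p xor_) (xor-same q) ⟩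
  p xor false      ≡⟨ xor-identityʳ p ⟩
  p                ∎

xor-interchange : ∀ a b c d → (a xor b) xor (c xor d) ≡ (a xor c) xor (b xor d)
xor-interchange = solve-∀ GF2

infixl 7 _·_
infixl 6 _⊕_
infixr 8 _∗_

_·_ : Vec Bool m → Vec Bool m → Bool
[] · [] = false
(x ∷ u) · (y ∷ v) = (x ∧ y) xor (u · v)

_⊕_ : Vec Bool m → Vec Bool m → Vec Bool m
_⊕_ = zipWith _xor_

_∗_ : Bool → Vec Bool m → Vec Bool m
s ∗ u = map (s ∧_) u

·-comm : (u v : Vec Bool m) → u · v ≡ v · u
·-comm [] [] = refl
·-comm (x ∷ u) (y ∷ v) = cong₂ _xor_ (∧-comm x y) (·-comm u v)

·-⊕ˡ : (u w v : Vec Bool m) → (u ⊕ w) · v ≡ (u · v) xor (w · v)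
·-⊕ˡ [] [] [] = refl
·-⊕ˡ (x ∷ u) (z ∷ w) (y ∷ v) = begin
  ((x xor z) ∧ y) xor ((u ⊕ w) · v)
    ≡⟨ cong₂ _xor_ (∧-distribʳ-xor y x z) (·-⊕ˡ u w v) ⟩
  ((x ∧ y) xor (z ∧ y)) xor ((u · v) xor (w · v))
    ≡⟨ xor-interchange (x ∧ y) (z ∧ y) (u · v) (w · v) ⟩
  ((x ∧ y) xor (u · v)) xor ((z ∧ y) xor (w · v))
    ∎

·-∗ˡ : ∀ s (u v : Vec Bool m) → (s ∗ u) · v ≡ s ∧ (u · v)
·-∗ˡ s [] [] = sym (∧-zeroʳ s)
·-∗ˡ s (x ∷ u) (y ∷ v) = begin
  ((s ∧ x) ∧ y) xor ((s ∗ u) · v)  ≡⟨ cong₂ _xor_ (∧-assoc s x y) (·-∗ˡ s u v) ⟩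
  (s ∧ (x ∧ y)) xor (s ∧ (u · v))  ≡⟨ sym (∧-distribˡ-xor s (x ∧ y) (u · v)) ⟩
  s ∧ ((x ∧ y) xor (u · v))        ∎

·-∗ʳ : ∀ s (u v : Vec Bool m) → u · (s ∗ v) ≡ s ∧ (u · v)
·-∗ʳ s u v = begin
  u · (s ∗ v)    ≡⟨ ·-comm u (s ∗ v) ⟩
  (s ∗ v) · u    ≡⟨ ·-∗ˡ s v u ⟩
  s ∧ (v · u)    ≡⟨ cong (s ∧_) (·-comm v u) ⟩
  s ∧ (u · v)    ∎

·-++ : ∀ {m′} (u v : Vec Bool m) (u′ v′ : Vec Bool m′) →
       (u ++ u′) · (v ++ v′) ≡ (u · v) xor (u′ · v′)
·-++ [] [] u′ v′ = refl
·-++ (x ∷ u) (y ∷ v) u′ v′ = begin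
  (x ∧ y) xor ((u ++ u′) · (v ++ v′))    ≡⟨ cong ((x ∧ y) xor_) (·-++ u v u′ v′) ⟩
  (x ∧ y) xor ((u · v) xor (u′ · v′))    ≡⟨ sym (xor-assoc (x ∧ y) (u · v) (u′ · v′)) ⟩
  ((x ∧ y) xor (u · v)) xor (u′ · v′)    ∎

·-zeroˡ : (v : Vec Bool m) → replicate m false · v ≡ false
·-zeroˡ [] = refl
·-zeroˡ (_ ∷ v) = ·-zeroˡ v

·-empty : (u v : Vec Bool 0) → u · v ≡ false
·-empty [] [] = refl

·-removeAt : (u v : Vec Bool (suc m)) (c : Fin (suc m)) →
             u · v ≡ (removeAt u c · removeAt v c) xor (lookup u c ∧ lookup v c)
·-removeAt (x ∷ u) (y ∷ v) zero = xor-comm (x ∧ y) (u · v)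
·-removeAt (x ∷ u@(_ ∷ _)) (y ∷ v@(_ ∷ _)) (suc c) = begin
  (x ∧ y) xor (u · v)
    ≡⟨ cong ((x ∧ y) xor_) (·-removeAt u v c) ⟩
  (x ∧ y) xor ((removeAt u c · removeAt v c) xor (lookup u c ∧ lookup v c))
    ≡⟨ sym (xor-assoc (x ∧ y) _ _) ⟩
  ((x ∧ y) xor (removeAt u c · removeAt v c)) xor (lookup u c ∧ lookup v c)
    ∎

·-true⇒nonzero : (u v : Vec Bool m) → u · v ≡ true → ∃ λ c → lookup u c ≡ true
·-true⇒nonzero [] [] ()
·-true⇒nonzero (true ∷ u) (true ∷ v) _ = zero , refl
·-true⇒nonzero (true ∷ u) (false ∷ v) uv = let c , u_c = ·-true⇒nonzero u v uv in suc c , u_c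
·-true⇒nonzero (false ∷ u) (y ∷ v) uv = let c , u_c = ·-true⇒nonzero u v uv in suc c , u_c

-- One step of Gaussian elimination: clearing coordinate c of u with a pivot
-- p (p_c = 1) orthogonal to v preserves u · v, after which c can be deleted.
eliminate : (u p v : Vec Bool (suc m)) (c : Fin (suc m)) →
            lookup p c ≡ true → p · v ≡ false →
            removeAt (u ⊕ lookup u c ∗ p) c · removeAt v c ≡ u · v
eliminate u p v c p_c≡1 p·v≡0 = begin
  removeAt w c · removeAt v c
    ≡⟨ sym (xor-identityʳ _) ⟩
  (removeAt w c · removeAt v c) xor (false ∧ lookup v c)
    ≡⟨ cong (λ t → (removeAt w c · removeAt v c) xor (t ∧ lookup v c)) (sym w_c≡0) ⟩
  (removeAt w c · removeAt v c) xor (lookup w c ∧ lookup v c)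
    ≡⟨ sym (·-removeAt w v c) ⟩
  w · v
    ≡⟨ ·-⊕ˡ u (s ∗ p) v ⟩
  (u · v) xor ((s ∗ p) · v)
    ≡⟨ cong ((u · v) xor_) (trans (·-∗ˡ s p v) (cong (s ∧_) p·v≡0)) ⟩
  (u · v) xor (s ∧ false)
    ≡⟨ trans (cong ((u · v) xor_) (∧-zeroʳ s)) (xor-identityʳ (u · v)) ⟩
  u · v
    ∎
  where
  s = lookup u c
  w = u ⊕ s ∗ p
  w_c≡0 : lookup w c ≡ false
  w_c≡0 = begin
    lookup w c               ≡⟨ lookup-zipWith _xor_ c u (s ∗ p) ⟩
    s xor lookup (s ∗ p) c   ≡⟨ cong (s xor_) (lookup-map c (s ∧_) p) ⟩
    s xor (s ∧ lookup p c)   ≡⟨ cong (λ t → s xor (s ∧ t)) p_c≡1 ⟩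
    s xor (s ∧ true)         ≡⟨ cong (s xor_) (∧-identityʳ s) ⟩
    s xor s                  ≡⟨ xor-same s ⟩
    false                    ∎

identity-rank : ∀ {X : Set} (A : List X) → Unique A → (U V : X → Vec Bool m) →
                (∀ {a} → a ∈ A → U a · V a ≡ true) →
                (∀ {a b} → a ∈ A → b ∈ A → a ≢ b → U a · V b ≡ false) →
                length A ≤ m
identity-rank [] _ _ _ _ _ = z≤n
identity-rank {zero} (a ∷ _) _ U V diagonal _
  with () ← trans (sym (·-empty (U a) (V a))) (diagonal (here refl))
identity-rank {suc m} (a ∷ A) (a∉A ∷ unique) U V diagonal off-diagonal =
  s≤s (identity-rank A unique U′ V′
        (λ x∈A → trans (preserved x∈A) (diagonal (there x∈A)))
        (λ x∈A y∈A x≢y → trans (preserved y∈A) (off-diagonal (there x∈A) (there y∈A) x≢y)))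
  where
  pivot = ·-true⇒nonzero (U a) (V a) (diagonal (here refl))
  c = proj₁ pivot
  U′ V′ : _ → Vec Bool m
  U′ x = removeAt (U x ⊕ lookup (U x) c ∗ U a) c
  V′ y = removeAt (V y) c
  preserved : ∀ {x y} → y ∈ A → U′ x · V′ y ≡ U x · V y
  preserved {x} {y} y∈A = eliminate (U x) (U a) (V y) c (proj₂ pivot)
    (off-diagonal (here refl) (there y∈A) (All.lookup a∉A y∈A))

-- A polynomial in x₀, x₁, …, xₙ₋₁ is g + x₀·h with g, h in x₁, …, xₙ₋₁.
Poly : ℕ → Set
Poly zero = Bool
Poly (suc n) = Poly n × Poly n

eval : Poly n → Subset n → Bool
eval {zero} c [] = c
eval {suc n} (g , h) (x ∷ X) = eval g X xor (x ∧ eval h X)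

coeff : Poly n → Subset n → Bool
coeff {zero} c [] = c
coeff {suc n} (g , h) (false ∷ Y) = coeff g Y
coeff {suc n} (g , h) (true ∷ Y) = coeff h Y

DegLt : ℕ → Poly n → Set
DegLt D P = ∀ Y → coeff P Y ≡ true → ∣ Y ∣ < D

-- Degree bounds weaken, and pass to the parts g and h of g + x₀h
-- (h loses the variable x₀, so its degree drops by one).
degLt-weaken : ∀ {D D′} {P : Poly n} → D ≤ D′ → DegLt D P → DegLt D′ P
degLt-weaken D≤D′ deg Y c = ≤-trans (deg Y c) D≤D′

degLt-const-part : ∀ {D} {g h : Poly n} → DegLt D (g , h) → DegLt D g
degLt-const-part deg Y c = deg (false ∷ Y) c

degLt-x₀-part : ∀ {D} {g h : Poly n} → DegLt D (g , h) → DegLt (pred D) h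
degLt-x₀-part deg Y c = pred-mono-≤ (deg (true ∷ Y) c)

record Interpolant (F : Family n) (f : Subset n → Bool) : Set where
  field
    poly      : Poly n
    agrees    : ∀ X → F X → eval poly X ≡ f X
    shattered : ∀ Y → coeff poly Y ≡ true → Shatters F Y
open Interpolant

shatters-∷false : (F : Family (suc n)) (Y : Subset n) →
                  Shatters (λ X → F (false ∷ X) ⊎ F (true ∷ X)) Y → Shatters F (false ∷ Y)
shatters-∷false F Y sh (true ∷ Z) Z⊆Y with () ← Z⊆Y here
shatters-∷false F Y sh (false ∷ Z) Z⊆Y with sh Z (drop-∷-⊆ Z⊆Y)
... | S , inj₁ F0S , S∩Y≡Z = false ∷ S , F0S , cong (false ∷_) S∩Y≡Z
... | S , inj₂ F1S , S∩Y≡Z = true ∷ S , F1S , cong (false ∷_) S∩Y≡Z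

shatters-∷true : (F : Family (suc n)) (Y : Subset n) →
                 Shatters (λ X → F (false ∷ X) × F (true ∷ X)) Y → Shatters F (true ∷ Y)
shatters-∷true F Y sh (z ∷ Z) Z⊆Y with sh Z (drop-∷-⊆ Z⊆Y)
shatters-∷true F Y sh (false ∷ Z) Z⊆Y | S , (F0S , _) , S∩Y≡Z = false ∷ S , F0S , cong (false ∷_) S∩Y≡Z
shatters-∷true F Y sh (true ∷ Z) Z⊆Y | S , (_ , F1S) , S∩Y≡Z = true ∷ S , F1S , cong (true ∷_) S∩Y≡Z

-- Writing
-- P = g + x₀h: h interpolates f(1X) + f(0X) on F₀ ∩ F₁, and g interpolates
-- on F₀ ∪ F₁ the value forced by whichever of 0X, 1X lies in F.
interpolate : (F : Family n) → (∀ X → Dec (F X)) → (f : Subset n → Bool) → Interpolant F f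
interpolate {zero} F F? f with F? []
... | yes F[] = record
  { poly = f [] ; agrees = λ { [] _ → refl }
  ; shattered = λ { [] _ [] _ → [] , F[] , refl } }
... | no ¬F[] = record
  { poly = false ; agrees = λ { [] F[] → ⊥-elim (¬F[] F[]) } ; shattered = λ { [] () } }
interpolate {suc n} F F? f = record
  { poly = poly G , poly H ; agrees = agrees-F ; shattered = shattered-F }
  where
  F₀ F₁ : Family n
  F₀ X = F (false ∷ X)
  F₁ X = F (true ∷ X)
  H : Interpolant (λ X → F₀ X × F₁ X) (λ X → f (true ∷ X) xor f (false ∷ X))
  H = interpolate _ (λ X → F? (false ∷ X) ×-dec F? (true ∷ X)) _
  forced : ∀ X → Dec (F₀ X) → Bool
  forced X (yes _) = f (false ∷ X)
  forced X (no _) = f (true ∷ X) xor eval (poly H) X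
  G : Interpolant (λ X → F₀ X ⊎ F₁ X) (λ X → forced X (F? (false ∷ X)))
  G = interpolate _ (λ X → F? (false ∷ X) ⊎-dec F? (true ∷ X)) _
  forced-0 : ∀ X → F₀ X → (F₀X? : Dec (F₀ X)) → forced X F₀X? ≡ f (false ∷ X)
  forced-0 X _ (yes _) = refl
  forced-0 X F₀X (no ¬F₀X) = ⊥-elim (¬F₀X F₀X)
  forced-1 : ∀ X → F₁ X → (F₀X? : Dec (F₀ X)) → forced X F₀X? xor eval (poly H) X ≡ f (true ∷ X)
  forced-1 X F₁X (yes F₀X) = begin
    f (false ∷ X) xor eval (poly H) X
      ≡⟨ cong (f (false ∷ X) xor_) (agrees H X (F₀X , F₁X)) ⟩
    f (false ∷ X) xor (f (true ∷ X) xor f (false ∷ X))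
      ≡⟨ xor-comm (f (false ∷ X)) _ ⟩
    (f (true ∷ X) xor f (false ∷ X)) xor f (false ∷ X)
      ≡⟨ xor-cancelʳ _ _ ⟩
    f (true ∷ X)
      ∎
  forced-1 X _ (no _) = xor-cancelʳ _ _
  agrees-F : ∀ X → F X → eval (poly G , poly H) X ≡ f X
  agrees-F (false ∷ X) FX =
    trans (xor-identityʳ _) (trans (agrees G X (inj₁ FX)) (forced-0 X FX (F? (false ∷ X))))
  agrees-F (true ∷ X) FX =
    trans (cong (_xor eval (poly H) X) (agrees G X (inj₂ FX))) (forced-1 X FX (F? (false ∷ X)))
  shattered-F : ∀ Y → coeff (poly G , poly H) Y ≡ true → Shatters F Y
  shattered-F (false ∷ Y) c = shatters-∷false F Y (shattered G Y c)
  shattered-F (true ∷ Y) c = shatters-∷true F Y (shattered H Y c)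

interpolant-degree : ∀ {F : Family n} {f d} (I : Interpolant F f) →
                     VCDimAtMost F d → DegLt (suc d) (poly I)
interpolant-degree I vc Y c = s≤s (vc Y (shattered I Y c))

-- number of monomials of degree < j in n variables
monoCount : ℕ → ℕ → ℕ
monoCount zero zero = 0
monoCount zero (suc _) = 1
monoCount (suc n) j = monoCount n j + monoCount n (pred j)

-- the values at X of all monomials of degree < j
mons : ∀ j → Subset n → Vec Bool (monoCount n j)
mons {zero} zero [] = []
mons {zero} (suc j) [] = true ∷ []
mons {suc n} j (x ∷ X) = mons j X ++ x ∗ mons (pred j) X

-- P(a ⊕ b) = Σ_{|Y|<j} G_Y(b)·a^Y + Σ_{|Y|<l} T_Y(a)·b^Y, where
-- coeffs-a b = (G_Y(b))_Y and coeffs-b a = (T_Y(a))_Y.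
record Splitting (j l : ℕ) (P : Poly n) : Set where
  field
    coeffs-a : Subset n → Vec Bool (monoCount n j)
    coeffs-b : Subset n → Vec Bool (monoCount n l)
    splits   : ∀ a b → eval P (a ⊕ b) ≡ (coeffs-a b · mons j a) xor (coeffs-b a · mons l b)
open Splitting

-- Degree budgets for the two recursive splittings of h.
pred[j+l]≤pred[j]+l : ∀ j l → pred (j + l) ≤ pred j + l
pred[j+l]≤pred[j]+l zero l = pred[n]≤n
pred[j+l]≤pred[j]+l (suc j) l = ≤-refl

pred[j+l]≤j+pred[l] : ∀ j l → pred (j + l) ≤ j + pred l
pred[j+l]≤j+pred[l] j zero = pred[n]≤n
pred[j+l]≤j+pred[l] j (suc l) = ≤-reflexive (cong pred (+-suc j l))

·-block : ∀ {m′} (v w u : Vec Bool m) (v′ u′ : Vec Bool m′) s t →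
          ((v ⊕ t ∗ w) ++ v′) · (u ++ s ∗ u′) ≡ ((v · u) xor (t ∧ (w · u))) xor (s ∧ (v′ · u′))
·-block v w u v′ u′ s t = begin
  ((v ⊕ t ∗ w) ++ v′) · (u ++ s ∗ u′)
    ≡⟨ ·-++ (v ⊕ t ∗ w) u v′ (s ∗ u′) ⟩
  ((v ⊕ t ∗ w) · u) xor (v′ · (s ∗ u′))
    ≡⟨ cong₂ _xor_ (trans (·-⊕ˡ v (t ∗ w) u) (cong ((v · u) xor_) (·-∗ˡ t w u))) (·-∗ʳ s v′ u′) ⟩
  ((v · u) xor (t ∧ (w · u))) xor (s ∧ (v′ · u′))
    ∎

regroup : ∀ a₀ b₀ p q r s t u →
          (p xor q) xor ((a₀ ∧ (r xor s)) xor (b₀ ∧ (t xor u))) ≡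
          ((p xor (b₀ ∧ t)) xor (a₀ ∧ r)) xor ((q xor (a₀ ∧ s)) xor (b₀ ∧ u))
regroup = solve-∀ GF2

-- For P = g + x₀h:
-- P(a ⊕ b) = g(a′ ⊕ b′) + a₀h(a′ ⊕ b′) + b₀h(a′ ⊕ b′), splitting g with (j, l),
-- the a₀-term with (j - 1, l) and the b₀-term with (j, l - 1).
split : ∀ j l (P : Poly n) → DegLt (j + l) P → Splitting j l P
split {zero} zero zero false _ = record
  { coeffs-a = λ _ → [] ; coeffs-b = λ _ → [] ; splits = λ { [] [] → refl } }
split {zero} zero zero true deg with () ← deg [] refl
split {zero} (suc j) l c _ = record
  { coeffs-a = λ _ → c ∷ [] ; coeffs-b = λ _ → replicate _ false
  ; splits = λ { [] [] → sym (trans (cong₂ _xor_ (trans (xor-identityʳ _) (∧-identityʳ c)) (·-zeroˡ (mons l [])))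
                                    (xor-identityʳ c)) } }
split {zero} zero (suc l) c _ = record
  { coeffs-a = λ _ → [] ; coeffs-b = λ _ → c ∷ []
  ; splits = λ { [] [] → sym (trans (xor-identityʳ _) (∧-identityʳ c)) } }
split {suc n} j l (g , h) deg = record
  { coeffs-a = G ; coeffs-b = T ; splits = λ { (a₀ ∷ a) (b₀ ∷ b) → step a₀ a b₀ b } }
  where
  Sg = split j l g (degLt-const-part deg)
  Sa = split (pred j) l h (degLt-weaken (pred[j+l]≤pred[j]+l j l) (degLt-x₀-part deg))
  Sb = split j (pred l) h (degLt-weaken (pred[j+l]≤j+pred[l] j l) (degLt-x₀-part deg))
  G T : Subset (suc n) → Vec Bool _
  G (b₀ ∷ b) = (coeffs-a Sg b ⊕ b₀ ∗ coeffs-a Sb b) ++ coeffs-a Sa b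
  T (a₀ ∷ a) = (coeffs-b Sg a ⊕ a₀ ∗ coeffs-b Sa a) ++ coeffs-b Sb a
  step : ∀ a₀ a b₀ b → eval (g , h) ((a₀ ∷ a) ⊕ (b₀ ∷ b)) ≡
         (G (b₀ ∷ b) · mons j (a₀ ∷ a)) xor (T (a₀ ∷ a) · mons l (b₀ ∷ b))
  step a₀ a b₀ b = begin
    eval g (a ⊕ b) xor ((a₀ xor b₀) ∧ eval h (a ⊕ b))
      ≡⟨ cong (eval g (a ⊕ b) xor_) (∧-distribʳ-xor _ a₀ b₀) ⟩
    eval g (a ⊕ b) xor ((a₀ ∧ eval h (a ⊕ b)) xor (b₀ ∧ eval h (a ⊕ b)))
      ≡⟨ cong₂ _xor_ (splits Sg a b) (cong₂ _xor_ (cong (a₀ ∧_) (splits Sa a b))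
                                                  (cong (b₀ ∧_) (splits Sb a b))) ⟩
    ((Gg · M) xor (Tg · N)) xor ((a₀ ∧ ((Ga · M′) xor (Ta · N))) xor (b₀ ∧ ((Gb · M) xor (Tb · N′))))
      ≡⟨ regroup a₀ b₀ (Gg · M) (Tg · N) (Ga · M′) (Ta · N) (Gb · M) (Tb · N′) ⟩
    (((Gg · M) xor (b₀ ∧ (Gb · M))) xor (a₀ ∧ (Ga · M′))) xor
      (((Tg · N) xor (a₀ ∧ (Ta · N))) xor (b₀ ∧ (Tb · N′)))
      ≡⟨ sym (cong₂ _xor_ (·-block Gg Gb M Ga M′ a₀ b₀) (·-block Tg Ta N Tb N′ b₀ a₀)) ⟩
    (G (b₀ ∷ b) · mons j (a₀ ∷ a)) xor (T (a₀ ∷ a) · mons l (b₀ ∷ b))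
      ∎
    where
    M = mons j a
    M′ = mons (pred j) a
    N = mons l b
    N′ = mons (pred l) b
    Gg = coeffs-a Sg b
    Ga = coeffs-a Sa b
    Gb = coeffs-a Sb b
    Tg = coeffs-b Sg a
    Ta = coeffs-b Sa a
    Tb = coeffs-b Sb a

monoCount-zero : ∀ n → monoCount n 0 ≡ 0
monoCount-zero zero = refl
monoCount-zero (suc n) = cong₂ _+_ (monoCount-zero n) (monoCount-zero n)

choose≤-pascal : ∀ n k → choose≤ (suc n) (suc k) ≡ choose≤ n (suc k) + choose≤ n k
choose≤-pascal n zero = begin
  1 + suc n C 1        ≡⟨ cong (1 +_) (sym (nCk+nC[k+1]≡[n+1]C[k+1] n 0)) ⟩
  1 + (1 + n C 1)      ≡⟨ +-comm 1 (1 + n C 1) ⟩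
  (1 + n C 1) + 1      ∎
choose≤-pascal n (suc k) = begin
  choose≤ (suc n) (suc k) + suc n C suc (suc k)
    ≡⟨ cong₂ _+_ (choose≤-pascal n k) (sym (nCk+nC[k+1]≡[n+1]C[k+1] n (suc k))) ⟩
  (choose≤ n (suc k) + choose≤ n k) + (n C suc k + n C suc (suc k))
    ≡⟨ rearrange (choose≤ n (suc k)) (choose≤ n k) (n C suc k) (n C suc (suc k)) ⟩
  (choose≤ n (suc k) + n C suc (suc k)) + (choose≤ n k + n C suc k)
    ∎
  where
  rearrange : ∀ a b c d → (a + b) + (c + d) ≡ (a + d) + (b + c)
  rearrange = ℕ-Solver.solve-∀

monoCount≡choose≤ : ∀ n k → monoCount n (suc k) ≡ choose≤ n k
monoCount≡choose≤ zero zero = refl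
monoCount≡choose≤ zero (suc k) = trans (monoCount≡choose≤ zero k) (sym (+-identityʳ _))
monoCount≡choose≤ (suc n) zero = cong₂ _+_ (monoCount≡choose≤ n zero) (monoCount-zero n)
monoCount≡choose≤ (suc n) (suc k) =
  trans (cong₂ _+_ (monoCount≡choose≤ n (suc k)) (monoCount≡choose≤ n k)) (sym (choose≤-pascal n k))

dimension : ∀ n k → monoCount n (suc k) + monoCount n (suc k) ≡ 2 * choose≤ n k
dimension n k = begin
  monoCount n (suc k) + monoCount n (suc k)  ≡⟨ cong₂ _+_ (monoCount≡choose≤ n k) (monoCount≡choose≤ n k) ⟩
  choose≤ n k + choose≤ n k                  ≡⟨ cong (choose≤ n k +_) (sym (+-identityʳ _)) ⟩
  2 * choose≤ n k                            ∎

-- d + 1 ≤ 2(⌊d/2⌋ + 1): degree < d + 1 splits with j = l = ⌊d/2⌋ + 1.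
half-bound : ∀ d → suc d ≤ suc (d / 2) + suc (d / 2)
half-bound d = subst₂ _≤_ (cong suc (sym (m≡m%n+[m/n]*n d 2))) (twice-suc (d / 2))
                 (s≤s (+-monoˡ-≤ (d / 2 * 2) (≤-pred (m%n<n d 2))))
  where
  twice-suc : ∀ k → suc (1 + k * 2) ≡ suc k + suc k
  twice-suc = ℕ-Solver.solve-∀

△≡⊕ : (S T : Subset n) → S △ T ≡ S ⊕ T
△≡⊕ [] [] = refl
△≡⊕ (true ∷ S) (true ∷ T) = cong (false ∷_) (△≡⊕ S T)
△≡⊕ (true ∷ S) (false ∷ T) = cong (true ∷_) (△≡⊕ S T)
△≡⊕ (false ∷ S) (true ∷ T) = cong (true ∷_) (△≡⊕ S T)
△≡⊕ (false ∷ S) (false ∷ T) = cong (false ∷_) (△≡⊕ S T)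

Δ? : (A : List (Subset n)) → ∀ X → Dec (ΔFamily A X)
Δ? A X = map′ from-any to-any (any? (λ S → any? (λ T → ≡-dec Bool._≟_ X (S △ T)) A) A)
  where
  from-any : Any (λ S → Any (λ T → X ≡ S △ T) A) A → ΔFamily A X
  from-any p = let S , S∈A , q = find p ; T , T∈A , X≡S△T = find q in S , T , S∈A , T∈A , X≡S△T
  to-any : ΔFamily A X → Any (λ S → Any (λ T → X ≡ S △ T) A) A
  to-any (S , T , S∈A , T∈A , X≡S△T) = lose S∈A (lose T∈A X≡S△T)

-- The indicator of the empty set: the function interpolated on {S △ T},
-- since S △ T = ∅ exactly when S = T.
isEmpty : Subset n → Bool
isEmpty [] = true
isEmpty (x ∷ X) = not x ∧ isEmpty X

isEmpty-⊕-self : (a : Subset n) → isEmpty (a ⊕ a) ≡ true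
isEmpty-⊕-self [] = refl
isEmpty-⊕-self (true ∷ a) = isEmpty-⊕-self a
isEmpty-⊕-self (false ∷ a) = isEmpty-⊕-self a

isEmpty-⊕-distinct : (a b : Subset n) → a ≢ b → isEmpty (a ⊕ b) ≡ false
isEmpty-⊕-distinct [] [] a≢b = ⊥-elim (a≢b refl)
isEmpty-⊕-distinct (true ∷ a) (true ∷ b) a≢b = isEmpty-⊕-distinct a b (λ a≡b → a≢b (cong (true ∷_) a≡b))
isEmpty-⊕-distinct (false ∷ a) (false ∷ b) a≢b = isEmpty-⊕-distinct a b (λ a≡b → a≢b (cong (false ∷_) a≡b))
isEmpty-⊕-distinct (true ∷ a) (false ∷ b) _ = refl
isEmpty-⊕-distinct (false ∷ a) (true ∷ b) _ = refl

theorem2 : (d n : ℕ) → d ≤ n → (A : List (Subset n)) → Unique A →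
    VCDimAtMost (ΔFamily A) d →
    length A ≤ 2 * choose≤ n (d / 2)
theorem2 d n _ A unique vc =
  subst (length A ≤_) (dimension n k) (identity-rank A unique U V diagonal off-diagonal)
  where
  k = d / 2
  -- P(S △ T) = [S = T] on A, with deg P ≤ d
  I = interpolate (ΔFamily A) (Δ? A) isEmpty
  S = split (suc k) (suc k) (poly I) (degLt-weaken (half-bound d) (interpolant-degree I vc))
  U V : Subset n → Vec Bool (monoCount n (suc k) + monoCount n (suc k))
  U a = mons (suc k) a ++ coeffs-b S a
  V b = coeffs-a S b ++ mons (suc k) b
  U·V : ∀ {a b} → a ∈ A → b ∈ A → U a · V b ≡ isEmpty (a ⊕ b)
  U·V {a} {b} a∈A b∈A = begin
    U a · V b
      ≡⟨ ·-++ (mons (suc k) a) (coeffs-a S b) (coeffs-b S a) (mons (suc k) b) ⟩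
    (mons (suc k) a · coeffs-a S b) xor (coeffs-b S a · mons (suc k) b)
      ≡⟨ cong (_xor (coeffs-b S a · mons (suc k) b)) (·-comm (mons (suc k) a) (coeffs-a S b)) ⟩
    (coeffs-a S b · mons (suc k) a) xor (coeffs-b S a · mons (suc k) b)
      ≡⟨ sym (splits S a b) ⟩
    eval (poly I) (a ⊕ b)
      ≡⟨ cong (eval (poly I)) (sym (△≡⊕ a b)) ⟩
    eval (poly I) (a △ b)
      ≡⟨ agrees I (a △ b) (a , b , a∈A , b∈A , refl) ⟩
    isEmpty (a △ b)
      ≡⟨ cong isEmpty (△≡⊕ a b) ⟩
    isEmpty (a ⊕ b)
      ∎
  diagonal : ∀ {a} → a ∈ A → U a · V a ≡ true
  diagonal {a} a∈A = trans (U·V a∈A a∈A) (isEmpty-⊕-self a)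
  off-diagonal : ∀ {a b} → a ∈ A → b ∈ A → a ≢ b → U a · V b ≡ false
  off-diagonal {a} {b} a∈A b∈A a≢b = trans (U·V a∈A b∈A) (isEmpty-⊕-distinct a b a≢b)
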